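{- Let $P=(X,\le_P)$ be a finite connected poset and let $I,J\subseteq X$. Then: (1) if $I\circledcirc P$ and $J\circledcirc P$, then $I=J$ or $I\cap J=\emptyset$; (2) if $I\circledcirc P$, then $\min(P\setminus I)=\min(P)$; (3) if $I\circledcirc P$, then $P\setminus I$ is a connected poset.
   Context: A poset is connected if the graph on its elements with an edge between any two comparable distinct elements (its comparability graph) is connected; connected components of a subset of a poset are taken in the comparability graph of the induced subposet. $\min(P)$ is the set of minimal elements of $P$. For $S\subseteq X$, $P\setminus S$ denotes the subposet induced on $X\setminus S$. For $I\subseteq X$, put $I_-=\{x\in X\setminus I:\ \exists y\in I,\ x\le_P y\}$. One writes $I\circledcirc P$ if (i) $I_-$ is a singleton $\{w\}$ with $w\in\min(P)$, and (ii) $I$ is a connected component of the set $\{x\in X:\ w<_P x\}$. -}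

module Defs where

open import Level using (0ℓ)
open import Data.Nat using (ℕ)
open import Data.Fin using (Fin)
open import Data.Fin.Subset using (Subset; _∈_; _∉_)
open import Data.Product using (Σ; _×_; ∃; ∃-syntax)
open import Data.Sum using (_⊎_)
open import Data.Unit using (⊤)
open import Relation.Nullary using (¬_)
open import Relation.Unary using (Pred)
open import Relation.Binary.PropositionalEquality using (_≡_; _≢_)
open import Function.Bundles using (_⇔_)

-- A finite poset P = (Fin n, ≤) : the order is any relation ≤ with
-- IsPartialOrder _≡_ _≤_ (imposed in the statement).
module _ {n : ℕ} (_≤_ : Fin n → Fin n → Set) where

  _<_ : Fin n → Fin n → Set
  x < y = (x ≤ y) × (x ≢ y)

  -- comparability (edge of the comparability graph, up to self loops,
  -- which do not affect connectivity)
  Comparable : Fin n → Fin n → Set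
  Comparable x y = (x ≤ y) ⊎ (y ≤ x)

  Whole : Pred (Fin n) 0ℓ
  Whole _ = ⊤

  ⟦_⟧ : Subset n → Pred (Fin n) 0ℓ
  ⟦ I ⟧ x = x ∈ I

  Minus : Subset n → Pred (Fin n) 0ℓ
  Minus I x = x ∉ I

  data Reach (S : Pred (Fin n) 0ℓ) : Fin n → Fin n → Set where
    here : ∀ {x} → S x → Reach S x x
    step : ∀ {x y z} → S x → Comparable x y → Reach S y z → Reach S x z

  Connected : Pred (Fin n) 0ℓ → Set
  Connected S = ∀ x y → S x → S y → Reach S x y

  -- C is a connected component of S (in the comparability graph of the
  -- induced subposet): a nonempty subset of S, connected, and closed under
  -- reachability inside S (i.e. maximal)
  IsComponent : Pred (Fin n) 0ℓ → Pred (Fin n) 0ℓ → Set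
  IsComponent C S =
    (∀ x → C x → S x) ×
    (∃[ x ] C x) ×
    Connected C ×
    (∀ x y → C x → Reach S x y → C y)

  Minimal : Pred (Fin n) 0ℓ → Fin n → Set
  Minimal S x = S x × (∀ y → S y → y ≤ x → y ≡ x)

  Lower : Subset n → Pred (Fin n) 0ℓ
  Lower I x = (x ∉ I) × (∃[ y ] ((y ∈ I) × (x ≤ y)))

  StrictUp : Fin n → Pred (Fin n) 0ℓ
  StrictUp w x = w < x

  Circ : Subset n → Set
  Circ I = ∃[ w ] (
    (∀ x → Lower I x ⇔ (x ≡ w)) ×
    Minimal Whole w ×
    IsComponent ⟦ I ⟧ (StrictUp w))

{-# OPTIONS --safe #-}
module Submission where

-- Let I ⊚ P with base w. Every element of I lies strictly above w, and I is
-- closed upwards (anything above an element of I is joined to it inside the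
-- strict up-set of w). Hence an element outside I comparable to an element
-- of I must lie below it, i.e. belongs to I₋ = {w}. So a walk of the
-- comparability graph can enter or leave I only through w, and cutting out
-- its stretches inside I leaves a walk in P ∖ I: this gives (3). For (2),
-- upward closure keeps minimal elements of P ∖ I minimal in P, while no
-- element of I is minimal. For (1), if I and J meet at x with bases w ≠ w',
-- then w' ∉ I (it is minimal) yet w' < x ∈ I, so w' ∈ I₋ = {w}; with a common
-- base, I and J are components of the same set sharing x.

open import Defs
open import Level using (0ℓ)
open import Data.Nat using (ℕ)
open import Data.Fin using (Fin)
open import Data.Fin.Subset using (Subset; _∩_; Empty; _∈_; _∉_)
open import Data.Fin.Subset.Properties using (_∈?_; ⊆-antisym; x∈p∩q⁻; nonempty?)
open import Data.Product using (_×_; _,_; proj₁; proj₂)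
open import Data.Sum using (_⊎_; inj₁; inj₂)
open import Relation.Nullary using (¬_; yes; no; contradiction)
open import Relation.Unary using (Pred)
open import Relation.Binary.Structures using (IsPartialOrder)
open import Relation.Binary.PropositionalEquality using (_≡_; refl; sym; subst)
open import Function.Bundles using (_⇔_; mk⇔; Equivalence)

module _ {n : ℕ} (_≤_ : Fin n → Fin n → Set) where

  Comparable-sym : ∀ {x y} → Comparable _≤_ x y → Comparable _≤_ y x
  Comparable-sym (inj₁ x≤y) = inj₂ x≤y
  Comparable-sym (inj₂ y≤x) = inj₁ y≤x

  Reach-mono : {S T : Pred (Fin n) 0ℓ} → (∀ x → S x → T x) →
               ∀ {x y} → Reach _≤_ S x y → Reach _≤_ T x y
  Reach-mono S⊆T (here {x} Sx)         = here (S⊆T x Sx)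
  Reach-mono S⊆T (step {x} Sx x~y y⇝z) = step (S⊆T x Sx) x~y (Reach-mono S⊆T y⇝z)

  component-⊆ : {C D S : Pred (Fin n) 0ℓ} → IsComponent _≤_ C S → IsComponent _≤_ D S →
                ∀ {x} → C x → D x → ∀ y → C y → D y
  component-⊆ (C⊆S , _ , C-conn , _) (_ , _ , _ , D-closed) {x} Cx Dx y Cy =
    D-closed x y Dx (Reach-mono C⊆S (C-conn x y Cx Cy))

  Minimal-restrict : {S T : Pred (Fin n) 0ℓ} → (∀ x → S x → T x) →
                     ∀ {x} → S x → Minimal _≤_ T x → Minimal _≤_ S x
  Minimal-restrict S⊆T Sx (_ , x-min) = Sx , λ y Sy y≤x → x-min y (S⊆T y Sy) y≤x

module _ {n : ℕ} {_≤_ : Fin n → Fin n → Set} (po : IsPartialOrder _≡_ _≤_) where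
  open IsPartialOrder po using (antisym) renaming (trans to ≤-trans)

  <-≤-trans : ∀ {x y z} → _<_ _≤_ x y → y ≤ z → _<_ _≤_ x z
  <-≤-trans {y = y} (x≤y , x≢y) y≤z =
    ≤-trans x≤y y≤z , λ x≡z → x≢y (antisym x≤y (subst (y ≤_) (sym x≡z) y≤z))

  <⇒¬Minimal : {S : Pred (Fin n) 0ℓ} → ∀ {x y} → S x → _<_ _≤_ x y → ¬ Minimal _≤_ S y
  <⇒¬Minimal Sx (x≤y , x≢y) (_ , y-min) = x≢y (y-min _ Sx x≤y)

  module CircBase (I : Subset n) (w : Fin n) (I₋≡w : ∀ x → Lower _≤_ I x ⇔ (x ≡ w))
                  (I-comp : IsComponent _≤_ (⟦_⟧ _≤_ I) (StrictUp _≤_ w)) where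

    above-base : ∀ {i} → i ∈ I → _<_ _≤_ w i
    above-base {i} = proj₁ I-comp i

    ∈-upward : ∀ {i u} → i ∈ I → i ≤ u → u ∈ I
    ∈-upward {i} {u} i∈I i≤u =
      proj₂ (proj₂ (proj₂ I-comp)) i u i∈I
        (step (above-base i∈I) (inj₁ i≤u) (here (<-≤-trans (above-base i∈I) i≤u)))

    ∈⇒¬Minimal : ∀ {i} → i ∈ I → ¬ Minimal _≤_ (Whole _≤_) i
    ∈⇒¬Minimal i∈I = <⇒¬Minimal _ (above-base i∈I)

    comparable-across⇒base : ∀ {u i} → u ∉ I → i ∈ I → Comparable _≤_ u i → u ≡ w
    comparable-across⇒base {u} {i} u∉I i∈I (inj₁ u≤i) = Equivalence.to (I₋≡w u) (u∉I , i , i∈I , u≤i)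
    comparable-across⇒base u∉I i∈I (inj₂ i≤u) = contradiction (∈-upward i∈I i≤u) u∉I

    -- The walk is shortcut at w wherever it passes through I; the second
    -- component handles walks that start inside I.
    reroute : ∀ {b y} → Reach _≤_ (Whole _≤_) b y → y ∉ I →
              (b ∉ I → Reach _≤_ (Minus _≤_ I) b y) × (b ∈ I → Reach _≤_ (Minus _≤_ I) w y)
    reroute (here _) y∉I = here , λ y∈I → contradiction y∈I y∉I
    reroute (step {y = c} _ b~c c⇝y) y∉I with reroute c⇝y y∉I | c ∈? I
    ... | from-c , _ | no c∉I =
          (λ b∉I → step b∉I b~c (from-c c∉I))
        , (λ b∈I → subst (λ v → Reach _≤_ (Minus _≤_ I) v _)
                         (comparable-across⇒base c∉I b∈I (Comparable-sym _≤_ b~c)) (from-c c∉I))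
    ... | _ , from-w | yes c∈I =
          (λ b∉I → subst (λ v → Reach _≤_ (Minus _≤_ I) v _)
                         (sym (comparable-across⇒base b∉I c∈I b~c)) (from-w c∈I))
        , (λ _ → from-w c∈I)

  circ-connected : ∀ {I} → Connected _≤_ (Whole _≤_) → Circ _≤_ I → Connected _≤_ (Minus _≤_ I)
  circ-connected {I} conn (w , I₋≡w , _ , I-comp) x y x∉I y∉I =
    proj₁ (CircBase.reroute I w I₋≡w I-comp (conn x y _ _) y∉I) x∉I

  circ-minimal : ∀ {I} → Circ _≤_ I → ∀ x → Minimal _≤_ (Minus _≤_ I) x ⇔ Minimal _≤_ (Whole _≤_) x
  circ-minimal {I} (w , I₋≡w , _ , I-comp) x = mk⇔ to from
    where
    open CircBase I w I₋≡w I-comp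

    to : Minimal _≤_ (Minus _≤_ I) x → Minimal _≤_ (Whole _≤_) x
    to (x∉I , x-min) = _ , below
      where
      below : ∀ y → Whole _≤_ y → y ≤ x → y ≡ x
      below y _ y≤x with y ∈? I
      ... | yes y∈I = contradiction (∈-upward y∈I y≤x) x∉I
      ... | no y∉I  = x-min y y∉I y≤x

    from : Minimal _≤_ (Whole _≤_) x → Minimal _≤_ (Minus _≤_ I) x
    from x-min = Minimal-restrict _≤_ _ (λ x∈I → ∈⇒¬Minimal x∈I x-min) x-min

  circ-base-unique : ∀ {I J w w' x} → (∀ y → Lower _≤_ I y ⇔ (y ≡ w)) →
                     IsComponent _≤_ (⟦_⟧ _≤_ I) (StrictUp _≤_ w) →
                     Minimal _≤_ (Whole _≤_) w' → IsComponent _≤_ (⟦_⟧ _≤_ J) (StrictUp _≤_ w') →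
                     x ∈ I → x ∈ J → w' ≡ w
  circ-base-unique {I} {w' = w'} {x} I₋≡w I-comp w'-min J-comp x∈I x∈J with w' ∈? I
  ... | yes w'∈I = contradiction w'-min (CircBase.∈⇒¬Minimal I _ I₋≡w I-comp w'∈I)
  ... | no w'∉I  = Equivalence.to (I₋≡w w') (w'∉I , x , x∈I , proj₁ (proj₁ J-comp x x∈J))

  circ-meeting⇒≡ : ∀ {I J x} → Circ _≤_ I → Circ _≤_ J → x ∈ I → x ∈ J → I ≡ J
  circ-meeting⇒≡ (_ , I₋≡w , _ , I-comp) (_ , _ , w'-min , J-comp) x∈I x∈J
    with circ-base-unique I₋≡w I-comp w'-min J-comp x∈I x∈J
  ... | refl = ⊆-antisym (λ {y} → component-⊆ _≤_ I-comp J-comp x∈I x∈J y)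
                         (λ {y} → component-⊆ _≤_ J-comp I-comp x∈J x∈I y)

  circ-equal-or-disjoint : ∀ {I J} → Circ _≤_ I → Circ _≤_ J → (I ≡ J) ⊎ Empty (I ∩ J)
  circ-equal-or-disjoint {I} {J} cI cJ with nonempty? (I ∩ J)
  ... | no I∩J-empty    = inj₂ I∩J-empty
  ... | yes (x , x∈I∩J) = inj₁ (circ-meeting⇒≡ cI cJ x∈I x∈J)
    where
    x∈I = proj₁ (x∈p∩q⁻ I J x∈I∩J)
    x∈J = proj₂ (x∈p∩q⁻ I J x∈I∩J)

lemma3p3 : (n : ℕ) (_≤_ : Fin n → Fin n → Set) → IsPartialOrder _≡_ _≤_ →
    Connected _≤_ (Whole _≤_) → (I J : Subset n) →
    ((Circ _≤_ I → Circ _≤_ J → (I ≡ J) ⊎ Empty (I ∩ J)) ×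
     (Circ _≤_ I → ∀ x → Minimal _≤_ (Minus _≤_ I) x ⇔ Minimal _≤_ (Whole _≤_) x) ×
     (Circ _≤_ I → Connected _≤_ (Minus _≤_ I)))
lemma3p3 n _≤_ po conn I J =
  circ-equal-or-disjoint po , circ-minimal po , circ-connected po conn
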